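{- Fix an integer $s\ge0$. (a) Suppose $s>0$, $r\ge1$, and $n$ is the $r$th smallest label of some super-node. Then for every integer $i$ with $-r\le i\le s+1-r$, $$a_s(n-r-1)+1=a_s(n+i)=a_s(n-r+s+2)-1.$$ (b) If $v_s(n)$ is a level 1 node, then $a_s(n-1)=a_s(n)=a_s(n+1)-1$. (c) If $v_s(n)$ is a level 2 node, then $a_s(n-1)+1=a_s(n)=a_s(n+1)$.
   Context: Fix an integer $s\ge 0$. Let $\mathcal{T}_s$ be the following infinite graph. It has super-nodes (level 0 nodes) $s_1,s_2,s_3,\dots$, with $s_{i+1}$ adjacent to $s_i$ for each $i\ge1$. Each super-node $s_i$ has $2^{i-1}$ children (level 1 nodes), called in left-to-right order the 1st, 2nd, $\dots$, $2^{i-1}$th child of $s_i$. Each level 1 node has exactly one child, a level 2 node, and level 2 nodes have no children. In addition there is one isolated node $I$. The leaves of $\mathcal{T}_s$ are the level 2 nodes together with $I$. Nodes are labelled by positive integers as follows: $I$ gets label $1$; then for $i=1,2,3,\dots$ in turn, the super-node $s_i$ receives the next $s$ consecutive unused labels (no label at all if $s=0$), and then for $r=1,2,\dots,2^{i-1}$ in turn, the $r$th child of $s_i$ receives the next unused label and then its child (a leaf) receives the next unused label. Thus each positive integer labels exactly one node; $I$ and all level 1 and level 2 nodes get exactly one label, and each super-node gets $s$ consecutive labels. For $n\ge1$ let $v_s(n)$ be the node with label $n$, let $d_s(n)=1$ if $v_s(n)$ is a leaf and $d_s(n)=0$ otherwise, and let $a_s(n)=\sum_{k=1}^n d_s(k)$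 for $n\ge0$ (so $a_s(0)=0$). -}

module Defs where

open import Data.Nat using (ℕ; zero; suc; _+_; _*_; _∸_; _^_; _<?_; _≡ᵇ_)
open import Data.Nat.DivMod using (_/_; _%_)
open import Data.Bool using (Bool; true; false; if_then_else_)
open import Relation.Nullary using (yes; no)

-- Nodes of the graph T_s.
--   isolated      : the isolated node I
--   super i       : the super-node s_i           (i ≥ 1)
--   level1 i r    : the r-th child of s_i        (1 ≤ r ≤ 2^(i-1))
--   level2 i r    : the (unique) child of level1 i r
data Node : Set where
  isolated : Node
  super    : ℕ → Node
  level1   : ℕ → ℕ → Node
  level2   : ℕ → ℕ → Node

isLeaf : Node → Bool
isLeaf isolated     = true
isLeaf (super _)    = false
isLeaf (level1 _ _) = false
isLeaf (level2 _ _) = true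

sameNode : Node → Node → Bool
sameNode isolated isolated = true
sameNode (super i) (super j) = i ≡ᵇ j
sameNode (level1 i r) (level1 j t) = if i ≡ᵇ j then r ≡ᵇ t else false
sameNode (level2 i r) (level2 j t) = if i ≡ᵇ j then r ≡ᵇ t else false
sameNode _ _ = false

-- locate s i m fuel : the node carrying the label with offset m (0-based)
-- inside the labels starting at the block of super-node s_i.
-- Block i consists of s labels of s_i followed by 2^(i-1) pairs
-- (r-th child of s_i, its child), i.e. s + 2^i labels in total.
locate : ℕ → ℕ → ℕ → ℕ → Node
locate s i m zero = isolated   -- unreachable with sufficient fuel
locate s i m (suc f) with m <? s
... | yes _ = super i
... | no _ with (m ∸ s) <? (2 ^ i)
...   | yes _ = if ((m ∸ s) % 2) ≡ᵇ 0
                  then level1 i (suc ((m ∸ s) / 2))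
                  else level2 i (suc ((m ∸ s) / 2))
...   | no _  = locate s (suc i) (m ∸ (s + 2 ^ i)) f

-- v s n : the node with label n (n ≥ 1). Label 1 is I; labels ≥ 2 start
-- at block 1.  Fuel n suffices since every block has ≥ 2 labels.
-- (v s 0 is a junk value; label 0 does not exist.)
v : ℕ → ℕ → Node
v s zero          = isolated
v s (suc zero)    = isolated
v s (suc (suc k)) = locate s 1 k (suc (suc k))

d : ℕ → ℕ → ℕ
d s n = if isLeaf (v s n) then 1 else 0

a : ℕ → ℕ → ℕ
a s zero    = 0
a s (suc n) = a s n + d s (suc n)

countLabels : ℕ → Node → ℕ → ℕ
countLabels s x zero    = 0
countLabels s x (suc m) =
  countLabels s x m + (if sameNode (v s (suc m)) x then 1 else 0)

-- n is the r-th smallest label of the node carrying it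
-- (exactly r labels ≤ n belong to v s n, n itself included)
rank : ℕ → ℕ → ℕ
rank s n = countLabels s (v s n) n

data IsSuper : Node → Set where
  is-super : ∀ i → IsSuper (super i)

data IsLevel1 : Node → Set where
  is-level1 : ∀ i r → IsLevel1 (level1 i r)

data IsLevel2 : Node → Set where
  is-level2 : ∀ i r → IsLevel2 (level2 i r)

module Submission where

-- The labels 2, 3, 4, ... are cut into consecutive blocks: block i
-- (i ≥ 1) consists of the s labels of the super-node s_i followed by
-- 2^(i-1) pairs (level-1 node, level-2 node), so it has s + 2^i labels.
-- Writing every label n ≥ 2 as n = 2 + blockStart s b + m with offset
-- m < s + 2^(b+1) in block b+1 (the view 'Located'), the node v s n is
-- the explicit function 'blockNode' of (b+1, m): a super-node for m < s,
-- a level-1 node for even m - s, a level-2 node (a leaf) for odd m - s.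
--
-- The three parts then follow by inspecting d_s at neighbouring labels,
-- since a_s(n+1) = a_s(n) + d_s(n+1):
--  (b),(c) after a level-1 node comes its leaf; a level-2 node is followed
--          either by the next level-1 node or by the start of the next block;
--  (a)     a super-node label of rank r is  blockStart + 1 + r, the label
--          blockStart + 1 just before the block is a leaf, the s super labels
--          and the first level-1 node are not, and label blockStart + s + 3
--          is the first leaf of the block.

open import Defs
open import Data.Nat using (ℕ; _+_; _∸_; _≤_; _<_)
open import Data.Product using (_×_)
open import Relation.Binary.PropositionalEquality using (_≡_)

open import Data.Nat using (zero; suc; _*_; _^_; _<?_; _≡ᵇ_; z≤n; s≤s)
open import Data.Nat.Properties
open import Data.Nat.DivMod using (_/_; _%_; m%n<n; m*n%n≡0)
open import Data.Bool using (true; false; if_then_else_; T)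
open import Data.Bool.Properties using (T-≡)
open import Function.Bundles using (Equivalence)
open import Data.Unit using (tt)
open import Data.Product using (Σ; _,_; proj₁; proj₂)
open import Data.Sum using (inj₁; inj₂)
open import Data.Empty using (⊥-elim)
open import Relation.Nullary using (yes; no; ¬_)
open import Relation.Binary.PropositionalEquality using (refl; sym; trans; cong; cong₂; subst; module ≡-Reasoning)

even⇒suc-odd : ∀ x → x % 2 ≡ 0 → suc x % 2 ≡ 1
even⇒suc-odd zero          _ = refl
even⇒suc-odd (suc zero)    ()
even⇒suc-odd (suc (suc x)) e = even⇒suc-odd x e

odd⇒suc-even : ∀ x → x % 2 ≡ 1 → suc x % 2 ≡ 0
odd⇒suc-even zero          ()
odd⇒suc-even (suc zero)    _ = refl
odd⇒suc-even (suc (suc x)) o = odd⇒suc-even x o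

suc-even⇒odd : ∀ x → suc x % 2 ≡ 0 → x % 2 ≡ 1
suc-even⇒odd zero          ()
suc-even⇒odd (suc zero)    _ = refl
suc-even⇒odd (suc (suc x)) e = suc-even⇒odd x e

double-even : ∀ p → (2 * p) % 2 ≡ 0
double-even p = trans (cong (_% 2) (*-comm 2 p)) (m*n%n≡0 p 2)

even<double⇒suc< : ∀ x p → x % 2 ≡ 0 → x < 2 * p → suc x < 2 * p
even<double⇒suc< x p ev x<2p with m≤n⇒m<n∨m≡n x<2p
... | inj₁ lt = lt
... | inj₂ eq with trans (sym (even⇒suc-odd x ev)) (trans (cong (_% 2) eq) (double-even p))
...   | ()

-- The offset of the last pair inside 2^(b+1) is odd.
pow2-pred-odd : ∀ b → Σ ℕ λ q → (2 ^ suc b ≡ suc q) × (q % 2 ≡ 1)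
pow2-pred-odd b with 2 ^ suc b | m^n>0 2 (suc b) | double-even (2 ^ b)
... | suc q | _ | ev = q , refl , suc-even⇒odd q ev

blockSize : ℕ → ℕ → ℕ
blockSize s i = s + 2 ^ i

blockSize-pos : ∀ s i → 0 < blockSize s i
blockSize-pos s i = ≤-trans (m^n>0 2 i) (m≤n+m _ s)

-- blocksFrom s c b : total size of the b blocks c+1, ..., c+b.
blocksFrom : ℕ → ℕ → ℕ → ℕ
blocksFrom s c zero    = 0
blocksFrom s c (suc b) = blockSize s (suc c) + blocksFrom s (suc c) b

-- Each block has at least one label, so b blocks have at least b labels.
b≤blocksFrom : ∀ s c b → b ≤ blocksFrom s c b
b≤blocksFrom s c zero    = z≤n
b≤blocksFrom s c (suc b) = +-mono-≤ (blockSize-pos s (suc c)) (b≤blocksFrom s (suc c) b)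

blocksFrom-snoc : ∀ s c b → blocksFrom s c (suc b) ≡ blocksFrom s c b + blockSize s (suc (b + c))
blocksFrom-snoc s c zero    = +-identityʳ _
blocksFrom-snoc s c (suc b) = begin
  blockSize s (suc c) + blocksFrom s (suc c) (suc b)
    ≡⟨ cong (blockSize s (suc c) +_) (blocksFrom-snoc s (suc c) b) ⟩
  blockSize s (suc c) + (blocksFrom s (suc c) b + blockSize s (suc (b + suc c)))
    ≡⟨ sym (+-assoc (blockSize s (suc c)) _ _) ⟩
  blocksFrom s c (suc b) + blockSize s (suc (b + suc c))
    ≡⟨ cong (λ z → blocksFrom s c (suc b) + blockSize s (suc z)) (+-suc b c) ⟩
  blocksFrom s c (suc b) + blockSize s (suc (suc b + c)) ∎
  where open ≡-Reasoning

-- Block b+1 occupies the labels 2 + blockStart s b + m, m < blockSize s (b+1).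
blockStart : ℕ → ℕ → ℕ
blockStart s b = blocksFrom s 0 b

label : ℕ → ℕ → ℕ → ℕ
label s b m = suc (suc (blockStart s b + m))

blockStart-suc : ∀ s b → blockStart s (suc b) ≡ blockStart s b + blockSize s (suc b)
blockStart-suc s b = trans (blocksFrom-snoc s 0 b)
  (cong (λ z → blockStart s b + blockSize s (suc z)) (+-identityʳ b))

label-suc : ∀ s b m → suc (label s b m) ≡ label s b (suc m)
label-suc s b m = cong (λ z → suc (suc z)) (sym (+-suc (blockStart s b) m))

label-next-block : ∀ s b m → suc m ≡ blockSize s (suc b) → suc (label s b m) ≡ label s (suc b) 0
label-next-block s b m last = cong (λ z → suc (suc z)) (begin
  suc (blockStart s b + m)          ≡⟨ sym (+-suc (blockStart s b) m) ⟩
  blockStart s b + suc m            ≡⟨ cong (blockStart s b +_) last ⟩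
  blockStart s b + blockSize s (suc b) ≡⟨ sym (blockStart-suc s b) ⟩
  blockStart s (suc b)              ≡⟨ sym (+-identityʳ _) ⟩
  blockStart s (suc b) + 0          ∎)
  where open ≡-Reasoning

data Located (s : ℕ) : ℕ → Set where
  at : ∀ b m → m < blockSize s (suc b) → Located s (label s b m)

located : ∀ s k → Located s (suc (suc k))
located s zero = at 0 0 (blockSize-pos s 1)
located s (suc k) with located s k
... | at b m m<size with m≤n⇒m<n∨m≡n m<size
...   | inj₁ sm<size = subst (Located s) (sym (label-suc s b m)) (at b (suc m) sm<size)
...   | inj₂ last    = subst (Located s) (sym (label-next-block s b m last))
                         (at (suc b) 0 (blockSize-pos s (suc (suc b))))

-- The node at offset m of block i (valid for m < blockSize s i).
blockNode : ℕ → ℕ → ℕ → Node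
blockNode s i m with m <? s
... | yes _ = super i
... | no _  = if ((m ∸ s) % 2) ≡ᵇ 0
                then level1 i (suc ((m ∸ s) / 2))
                else level2 i (suc ((m ∸ s) / 2))

locate-here : ∀ s i m f → m < blockSize s i → locate s i m (suc f) ≡ blockNode s i m
locate-here s i m f m<size with m <? s
... | yes _ = refl
... | no m≮s with (m ∸ s) <? (2 ^ i)
...   | yes _ = refl
...   | no ¬< = ⊥-elim (¬< (subst (m ∸ s <_) (m+n∸m≡n s (2 ^ i)) (∸-monoˡ-< m<size (≮⇒≥ m≮s))))

locate-skip : ∀ s i m f → locate s i (blockSize s i + m) (suc f) ≡ locate s (suc i) m f
locate-skip s i m f with (blockSize s i + m) <? s
... | yes lt = ⊥-elim (<⇒≱ lt (≤-trans (m≤m+n s (2 ^ i)) (m≤m+n (blockSize s i) m)))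
... | no _ with (blockSize s i + m ∸ s) <? (2 ^ i)
...   | yes lt = ⊥-elim (<⇒≱ lt (subst (2 ^ i ≤_) (sym reduced) (m≤m+n (2 ^ i) m)))
  where
  reduced : blockSize s i + m ∸ s ≡ 2 ^ i + m
  reduced = trans (cong (_∸ s) (+-assoc s (2 ^ i) m)) (m+n∸m≡n s (2 ^ i + m))
...   | no _ = cong (λ z → locate s (suc i) z f) (m+n∸m≡n (blockSize s i) m)

locate-blocks : ∀ s c b m F → b < F → m < blockSize s (suc (b + c)) →
  locate s (suc c) (blocksFrom s c b + m) F ≡ blockNode s (suc (b + c)) m
locate-blocks s c zero    m (suc f) _ m<size = locate-here s (suc c) m f m<size
locate-blocks s c (suc b) m (suc F) (s≤s b<F) m<size = begin
  locate s (suc c) (blocksFrom s c (suc b) + m) (suc F)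
    ≡⟨ cong (λ z → locate s (suc c) z (suc F)) (+-assoc (blockSize s (suc c)) _ m) ⟩
  locate s (suc c) (blockSize s (suc c) + (blocksFrom s (suc c) b + m)) (suc F)
    ≡⟨ locate-skip s (suc c) (blocksFrom s (suc c) b + m) F ⟩
  locate s (suc (suc c)) (blocksFrom s (suc c) b + m) F
    ≡⟨ locate-blocks s (suc c) b m F b<F (subst (λ z → m < blockSize s (suc z)) (sym (+-suc b c)) m<size) ⟩
  blockNode s (suc (b + suc c)) m
    ≡⟨ cong (λ z → blockNode s (suc z) m) (+-suc b c) ⟩
  blockNode s (suc (suc b + c)) m ∎
  where open ≡-Reasoning

v-label : ∀ s b m → m < blockSize s (suc b) → v s (label s b m) ≡ blockNode s (suc b) m
v-label s b m m<size =
  subst (λ z → locate s 1 (blockStart s b + m) (label s b m) ≡ blockNode s (suc z) m) (+-identityʳ b)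
    (locate-blocks s 0 b m (label s b m) enough-fuel
      (subst (λ z → m < blockSize s (suc z)) (sym (+-identityʳ b)) m<size))
  where
  enough-fuel : b < label s b m
  enough-fuel = s≤s (≤-trans (b≤blocksFrom s 0 b) (≤-trans (m≤m+n _ m) (n≤1+n _)))

leafBit : Node → ℕ
leafBit x = if isLeaf x then 1 else 0

d-label : ∀ s b m → m < blockSize s (suc b) → d s (label s b m) ≡ leafBit (blockNode s (suc b) m)
d-label s b m m<size = cong leafBit (v-label s b m m<size)

blockNode-super : ∀ s i m → m < s → blockNode s i m ≡ super i
blockNode-super s i m m<s with m <? s
... | yes _ = refl
... | no m≮s = ⊥-elim (m≮s m<s)

leafBit-level1 : ∀ s i m → s ≤ m → (m ∸ s) % 2 ≡ 0 → leafBit (blockNode s i m) ≡ 0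
leafBit-level1 s i m s≤m ev with m <? s
... | yes m<s = refl
... | no _ rewrite ev = refl

leafBit-level2 : ∀ s i m → s ≤ m → (m ∸ s) % 2 ≡ 1 → leafBit (blockNode s i m) ≡ 1
leafBit-level2 s i m s≤m od with m <? s
... | yes m<s = ⊥-elim (<⇒≱ m<s s≤m)
... | no _ rewrite od = refl

-- The first s + 1 offsets of a block (super-node labels, first level-1 node) are not leaves.
leafBit-upto-s : ∀ s i m → m ≤ s → leafBit (blockNode s i m) ≡ 0
leafBit-upto-s s i m m≤s with m≤n⇒m<n∨m≡n m≤s
... | inj₁ m<s  = cong leafBit (blockNode-super s i m m<s)
... | inj₂ refl = leafBit-level1 s i m ≤-refl (cong (_% 2) (n∸n≡0 m))

blockNode-isSuper : ∀ s i m → IsSuper (blockNode s i m) → m < s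
blockNode-isSuper s i m _ with m <? s
... | yes m<s = m<s
blockNode-isSuper s i m p | no _ with (m ∸ s) % 2 ≡ᵇ 0
blockNode-isSuper s i m () | no _ | true
blockNode-isSuper s i m () | no _ | false

blockNode-isLevel1 : ∀ s i m → IsLevel1 (blockNode s i m) → (s ≤ m) × ((m ∸ s) % 2 ≡ 0)
blockNode-isLevel1 s i m _ with m <? s
blockNode-isLevel1 s i m () | yes _
... | no m≮s with (m ∸ s) % 2
... | zero = ≮⇒≥ m≮s , refl
blockNode-isLevel1 s i m () | no _ | suc _

blockNode-isLevel2 : ∀ s i m → IsLevel2 (blockNode s i m) → (s ≤ m) × ((m ∸ s) % 2 ≡ 1)
blockNode-isLevel2 s i m _ with m <? s
blockNode-isLevel2 s i m () | yes _
... | no m≮s with (m ∸ s) % 2 in r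
blockNode-isLevel2 s i m () | no _ | zero
... | suc zero    = ≮⇒≥ m≮s , refl
... | suc (suc _) = ⊥-elim (<⇒≱ (m%n<n (m ∸ s) 2) (subst (2 ≤_) (sym r) (s≤s (s≤s z≤n))))

a-flat : ∀ s n → d s (suc n) ≡ 0 → a s (suc n) ≡ a s n
a-flat s n d≡0 = trans (cong (a s n +_) d≡0) (+-identityʳ (a s n))

a-up : ∀ s n → d s (suc n) ≡ 1 → a s (suc n) ≡ a s n + 1
a-up s n d≡1 = cong (a s n +_) d≡1

a-+1 : ∀ s n → a s (n + 1) ≡ a s (suc n)
a-+1 s n = cong (a s) (+-comm n 1)

suc∸ : ∀ s m → s ≤ m → suc m ∸ s ≡ suc (m ∸ s)
suc∸ s m s≤m = +-∸-assoc 1 s≤m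

-- A level-1 node is never last in its block (its leaf follows it).
level1-not-last : ∀ s b m → s ≤ m → (m ∸ s) % 2 ≡ 0 →
  m < blockSize s (suc b) → suc m < blockSize s (suc b)
level1-not-last s b m s≤m ev m<size =
  subst (_< blockSize s (suc b)) (trans (+-suc s (m ∸ s)) (cong suc (m+[n∸m]≡n s≤m)))
    (+-monoʳ-< s (even<double⇒suc< (m ∸ s) (2 ^ b) ev pair<))
  where
  pair< : m ∸ s < 2 ^ suc b
  pair< = subst (m ∸ s <_) (m+n∸m≡n s _) (∸-monoˡ-< m<size s≤m)

d-after-level1 : ∀ s b m → m < blockSize s (suc b) → s ≤ m → (m ∸ s) % 2 ≡ 0 →
  d s (suc (label s b m)) ≡ 1
d-after-level1 s b m m<size s≤m ev = begin
  d s (suc (label s b m))                   ≡⟨ cong (d s) (label-suc s b m) ⟩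
  d s (label s b (suc m))                   ≡⟨ d-label s b (suc m) (level1-not-last s b m s≤m ev m<size) ⟩
  leafBit (blockNode s (suc b) (suc m))     ≡⟨ leafBit-level2 s (suc b) (suc m) (m≤n⇒m≤1+n s≤m)
                                                 (trans (cong (_% 2) (suc∸ s m s≤m)) (even⇒suc-odd (m ∸ s) ev)) ⟩
  1                                         ∎
  where open ≡-Reasoning

-- The label after a level-2 node is not a leaf: it is the next level-1
-- node of the block, or the first label of the next block.
d-after-level2 : ∀ s b m → m < blockSize s (suc b) → s ≤ m → (m ∸ s) % 2 ≡ 1 →
  d s (suc (label s b m)) ≡ 0
d-after-level2 s b m m<size s≤m od with m≤n⇒m<n∨m≡n m<size
... | inj₁ sm<size = begin
  d s (suc (label s b m))                   ≡⟨ cong (d s) (label-suc s b m) ⟩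
  d s (label s b (suc m))                   ≡⟨ d-label s b (suc m) sm<size ⟩
  leafBit (blockNode s (suc b) (suc m))     ≡⟨ leafBit-level1 s (suc b) (suc m) (m≤n⇒m≤1+n s≤m)
                                                 (trans (cong (_% 2) (suc∸ s m s≤m)) (odd⇒suc-even (m ∸ s) od)) ⟩
  0                                         ∎
  where open ≡-Reasoning
... | inj₂ last = begin
  d s (suc (label s b m))                   ≡⟨ cong (d s) (label-next-block s b m last) ⟩
  d s (label s (suc b) 0)                   ≡⟨ d-label s (suc b) 0 (blockSize-pos s (suc (suc b))) ⟩
  leafBit (blockNode s (suc (suc b)) 0)     ≡⟨ leafBit-upto-s s (suc (suc b)) 0 z≤n ⟩
  0                                         ∎
  where open ≡-Reasoning

part-level1 : ∀ s n → IsLevel1 (v s n) → (a s (n ∸ 1) ≡ a s n) × (a s n + 1 ≡ a s (n + 1))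
part-level1 s (suc (suc k)) isL1 with located s k
... | at b m m<size with blockNode-isLevel1 s (suc b) m (subst IsLevel1 (v-label s b m m<size) isL1)
...   | s≤m , ev =
  sym (a-flat s _ (trans (d-label s b m m<size) (leafBit-level1 s (suc b) m s≤m ev))) ,
  sym (trans (a-+1 s (label s b m)) (a-up s _ (d-after-level1 s b m m<size s≤m ev)))

part-level2 : ∀ s n → IsLevel2 (v s n) → (a s (n ∸ 1) + 1 ≡ a s n) × (a s n ≡ a s (n + 1))
part-level2 s (suc (suc k)) isL2 with located s k
... | at b m m<size with blockNode-isLevel2 s (suc b) m (subst IsLevel2 (v-label s b m m<size) isL2)
...   | s≤m , od =
  sym (a-up s _ (trans (d-label s b m m<size) (leafBit-level2 s (suc b) m s≤m od))) ,
  sym (trans (a-+1 s (label s b m)) (a-flat s _ (d-after-level2 s b m m<size s≤m od)))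

-- The label just before block b+1 is a leaf: I for b = 0, and the
-- level-2 node closing block b otherwise.
leaf-before-block : ∀ s b → d s (suc (blockStart s b)) ≡ 1
leaf-before-block s zero    = refl
leaf-before-block s (suc b) with pow2-pred-odd b
... | q , pow≡ , q-odd = begin
  d s (suc (blockStart s (suc b)))      ≡⟨ cong (d s) last-label ⟩
  d s (label s b (s + q))               ≡⟨ d-label s b (s + q) (+-monoʳ-< s (subst (q <_) (sym pow≡) ≤-refl)) ⟩
  leafBit (blockNode s (suc b) (s + q)) ≡⟨ leafBit-level2 s (suc b) (s + q) (m≤m+n s q)
                                             (trans (cong (_% 2) (m+n∸m≡n s q)) q-odd) ⟩
  1                                     ∎
  where
  open ≡-Reasoning
  last-label : suc (blockStart s (suc b)) ≡ label s b (s + q)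
  last-label = cong suc (begin
    blockStart s (suc b)                 ≡⟨ blockStart-suc s b ⟩
    blockStart s b + (s + 2 ^ suc b)     ≡⟨ cong (λ z → blockStart s b + (s + z)) pow≡ ⟩
    blockStart s b + (s + suc q)         ≡⟨ cong (blockStart s b +_) (+-suc s q) ⟩
    blockStart s b + suc (s + q)         ≡⟨ +-suc (blockStart s b) (s + q) ⟩
    suc (blockStart s b + (s + q))       ∎)

a-flat-block-start : ∀ s b j → j ≤ s + 1 → a s (suc (blockStart s b) + j) ≡ a s (suc (blockStart s b))
a-flat-block-start s b zero    _ = cong (a s) (+-identityʳ (suc (blockStart s b)))
a-flat-block-start s b (suc j) j+1≤s+1 = begin
  a s (suc (blockStart s b) + suc j)   ≡⟨ cong (a s) (+-suc (suc (blockStart s b)) j) ⟩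
  a s (label s b j)                    ≡⟨ a-flat s _ (trans (d-label s b j j<size) (leafBit-upto-s s (suc b) j j≤s)) ⟩
  a s (suc (blockStart s b) + j)       ≡⟨ a-flat-block-start s b j (≤-trans j≤s (m≤m+n s 1)) ⟩
  a s (suc (blockStart s b))           ∎
  where
  open ≡-Reasoning
  j≤s : j ≤ s
  j≤s = ≤-pred (subst (suc j ≤_) (+-comm s 1) j+1≤s+1)
  j<size : j < blockSize s (suc b)
  j<size = ≤-trans j+1≤s+1 (+-monoʳ-≤ s (m^n>0 2 (suc b)))

-- Offset s + 1 (the second pair node) is the first leaf of block b+1.
a-first-leaf : ∀ s b → a s (suc (blockStart s b) + s + 2) ≡ a s (suc (blockStart s b)) + 1
a-first-leaf s b = begin
  a s (B + s + 2)          ≡⟨ cong (a s) B+s+2≡ ⟩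
  a s (label s b (s + 1))  ≡⟨ a-up s _ (trans (d-label s b (s + 1) s+1<size)
                                (leafBit-level2 s (suc b) (s + 1) (m≤m+n s 1) (cong (_% 2) (m+n∸m≡n s 1)))) ⟩
  a s (B + (s + 1)) + 1    ≡⟨ cong (_+ 1) (a-flat-block-start s b (s + 1) ≤-refl) ⟩
  a s B + 1                ∎
  where
  open ≡-Reasoning
  B = suc (blockStart s b)
  B+s+2≡ : B + s + 2 ≡ suc (B + (s + 1))
  B+s+2≡ = trans (+-assoc B s 2) (trans (cong (B +_) (+-suc s 1)) (+-suc B (s + 1)))
  s+1<size : s + 1 < blockSize s (suc b)
  s+1<size = +-monoʳ-< s (*-monoʳ-≤ 2 (m^n>0 2 b))

sameNode-other-block : ∀ s b′ b m → ¬ (b′ ≡ b) → sameNode (blockNode s (suc b′) m) (super (suc b)) ≡ false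
sameNode-other-block s b′ b m b′≢b with m <? s
... | yes _ with b′ ≡ᵇ b in e
...   | true  = ⊥-elim (b′≢b (≡ᵇ⇒≡ b′ b (subst T (sym e) tt)))
...   | false = refl
sameNode-other-block s b′ b m b′≢b | no _ with (m ∸ s) % 2 ≡ᵇ 0
... | true  = refl
... | false = refl

sameNode-before-block : ∀ s b k → suc (suc k) ≤ suc (blockStart s b) →
  sameNode (v s (suc (suc k))) (super (suc b)) ≡ false
sameNode-before-block s b k before with located s k
... | at b′ m′ m′<size =
  trans (cong (λ x → sameNode x (super (suc b))) (v-label s b′ m′ m′<size)) (sameNode-other-block s b′ b m′ b′≢b)
  where
  b′≢b : ¬ (b′ ≡ b)
  b′≢b refl = <⇒≱ (≤-pred before) (m≤m+n (blockStart s b) m′)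

count-before-block : ∀ s b L → L ≤ suc (blockStart s b) → countLabels s (super (suc b)) L ≡ 0
count-before-block s b zero          _      = refl
count-before-block s b (suc zero)    _      = refl
count-before-block s b (suc (suc k)) before =
  cong₂ (λ c x → c + (if x then 1 else 0))
    (count-before-block s b (suc k) (≤-trans (n≤1+n _) before))
    (sameNode-before-block s b k before)

count-super-labels : ∀ s b j → j ≤ s → countLabels s (super (suc b)) (suc (blockStart s b) + j) ≡ j
count-super-labels s b zero _ =
  count-before-block s b _ (≤-reflexive (+-identityʳ (suc (blockStart s b))))
count-super-labels s b (suc j) j+1≤s = begin
  countLabels s (super (suc b)) (suc (blockStart s b) + suc j)
    ≡⟨ cong (countLabels s (super (suc b))) (+-suc (suc (blockStart s b)) j) ⟩
  countLabels s (super (suc b)) (suc (blockStart s b) + j)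
    + (if sameNode (v s (label s b j)) (super (suc b)) then 1 else 0)
    ≡⟨ cong₂ (λ c x → c + (if sameNode x (super (suc b)) then 1 else 0))
         (count-super-labels s b j (≤-trans (n≤1+n j) j+1≤s))
         (trans (v-label s b j (≤-trans j+1≤s (m≤m+n s _))) (blockNode-super s (suc b) j j+1≤s)) ⟩
  j + (if b ≡ᵇ b then 1 else 0)
    ≡⟨ cong (λ x → j + (if x then 1 else 0)) (Equivalence.to T-≡ (≡⇒≡ᵇ b b refl)) ⟩
  j + 1
    ≡⟨ +-comm j 1 ⟩
  suc j ∎
  where open ≡-Reasoning

rank-super : ∀ s b m → m < s → rank s (label s b m) ≡ suc m
rank-super s b m m<s = begin
  countLabels s (v s (label s b m)) (label s b m)
    ≡⟨ cong (λ x → countLabels s x (label s b m))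
         (trans (v-label s b m (≤-trans m<s (m≤m+n s _))) (blockNode-super s (suc b) m m<s)) ⟩
  countLabels s (super (suc b)) (label s b m)
    ≡⟨ cong (countLabels s (super (suc b))) (sym (+-suc (suc (blockStart s b)) m)) ⟩
  countLabels s (super (suc b)) (suc (blockStart s b) + suc m)
    ≡⟨ count-super-labels s b (suc m) m<s ⟩
  suc m ∎
  where open ≡-Reasoning

around-block-start : ∀ s b j → j ≤ s + 1 →
  let B = suc (blockStart s b) in
  (a s (blockStart s b) + 1 ≡ a s (B + j)) × (a s (B + j) + 1 ≡ a s (B + s + 2))
around-block-start s b j j≤s+1 =
  trans (sym (a-up s (blockStart s b) (leaf-before-block s b))) (sym (a-flat-block-start s b j j≤s+1)) ,
  trans (cong (_+ 1) (a-flat-block-start s b j j≤s+1)) (sym (a-first-leaf s b))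

-- Part (a): a super-node label n of rank r sits r labels after the label
-- before its block.
part-super : (s r n : ℕ) → IsSuper (v s n) → rank s n ≡ r →
  (j : ℕ) → j ≤ s + 1 →
    (a s (n ∸ (r + 1)) + 1 ≡ a s (n ∸ r + j)) × (a s (n ∸ r + j) + 1 ≡ a s (n ∸ r + s + 2))
part-super s r (suc (suc k)) isSuper rank≡r j j≤s+1 with located s k
... | at b m m<size with blockNode-isSuper s (suc b) m (subst IsSuper (v-label s b m m<size) isSuper)
...   | m<s with trans (sym rank≡r) (rank-super s b m m<s)
...     | refl =
  trans (cong (λ x → a s x + 1) n∸[r+1]≡) (trans (proj₁ around) (cong (λ x → a s (x + j)) (sym n∸r≡))) ,
  subst (λ x → a s (x + j) + 1 ≡ a s (x + s + 2)) (sym n∸r≡) (proj₂ around)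
  where
  around = around-block-start s b j j≤s+1
  n∸r≡ : label s b m ∸ suc m ≡ suc (blockStart s b)
  n∸r≡ = m+n∸n≡m (suc (blockStart s b)) m
  n∸[r+1]≡ : label s b m ∸ (suc m + 1) ≡ blockStart s b
  n∸[r+1]≡ = trans (sym (∸-+-assoc (label s b m) (suc m) 1)) (cong (_∸ 1) n∸r≡)

lemma2p1 : (s : ℕ) →
    ((r n : ℕ) → 0 < s → 1 ≤ r → IsSuper (v s n) → rank s n ≡ r →
      (j : ℕ) → j ≤ s + 1 →
        (a s (n ∸ (r + 1)) + 1 ≡ a s (n ∸ r + j))
        × (a s (n ∸ r + j) + 1 ≡ a s (n ∸ r + s + 2)))
    × ((n : ℕ) → IsLevel1 (v s n) →
        (a s (n ∸ 1) ≡ a s n) × (a s n + 1 ≡ a s (n + 1)))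
    × ((n : ℕ) → IsLevel2 (v s n) →
        (a s (n ∸ 1) + 1 ≡ a s n) × (a s n ≡ a s (n + 1)))
lemma2p1 s = (λ r n _ _ → part-super s r n) , part-level1 s , part-level2 s
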